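{- Let $d\ge 1$, let $q$ be the order and $\epsilon$ the type of a finite classical polar space of rank $d$, and let $P_{r,s}$ ($0\le r,s\le d$) be the eigenvalues of the dual polar association scheme given below. For $0\le a<d$ and $0\le r\le d$ put $\lambda_r^a=\sum_{s=0}^a P_{r,d-s}$. Then for $a<d$, $$\lambda_0^a=\sum_{s=0}^a\genfrac{[}{]}{0pt}{}{d}{s}_q q^{\binom{d-s}{2}+(d-s)\epsilon},$$ and for $a<d$ and $r>0$, $$\lambda_r^a=(-1)^{r+a}\sum_{s=\max(a-r+1,0)}^{\min(a,d-r)}(-1)^sA(r,s,a),\quad A(r,s,a):=\genfrac{[}{]}{0pt}{}{d-r}{s}_q q^{\binom{d-r-s}{2}+(d-r-s)\epsilon}\genfrac{[}{]}{0pt}{}{r-1}{a-s}_q q^{\binom{r-a+s}{2}}.$$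
   Context: For a polar space of rank $d$ and type $\epsilon$ ($\epsilon=0,\frac12,1,1,\frac32,2$ for $Q^+(2d-1,q)$, $H(2d-1,q)$, $Q(2d,q)$, $W(2d-1,q)$, $H(2d,q)$, $Q^-(2d+1,q)$), let $A_i$ be the adjacency matrix on generators with $(A_i)_{xy}=1$ iff $d-\dim(x\cap y)=i$. These matrices have common eigenspaces $V_0,\dots,V_d$, and $A_s$ acts on $V_r$ as the scalar $$P_{r,s}=\sum_{t=\max(r-s,0)}^{\min(d-s,r)}(-1)^{r-t}\genfrac{[}{]}{0pt}{}{d-r}{d-s-t}_q\genfrac{[}{]}{0pt}{}{r}{t}_q q^{\binom{r-t}{2}+\binom{s-r+t}{2}+(s-r+t)\epsilon}.$$ Thus $\lambda_r^a$ is the eigenvalue of $\sum_{s=0}^aA_{d-s}$ on $V_r$. Gaussian coefficient $\genfrac{[}{]}{0pt}{}{n}{k}_q=\prod_{i=1}^k\frac{q^{n-i+1}-1}{q^i-1}$ for $0\le k\le n$, $0$ otherwise; $\binom m2=m(m-1)/2$. -}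

module Defs where

open import Data.Nat as ℕ using (ℕ; zero; suc; _∸_; _≤_; _<_; _⊔_; _⊓_)
open import Data.Nat.Combinatorics using (_C_)
open import Data.Nat.Primality using (Prime)
open import Data.Integer as ℤ using (ℤ; +_; -_)
open import Data.List using (List; map; upTo; foldr)
open import Data.Bool using (true; false)
open import Data.Product using (Σ; _×_)
open import Relation.Binary.PropositionalEquality using (_≡_)

-- The six types of finite classical polar spaces of rank d:
-- Q⁺(2d-1,q) (ε=0), H(2d-1,q) (ε=1/2), Q(2d,q) (ε=1), W(2d-1,q) (ε=1),
-- H(2d,q) (ε=3/2), Q⁻(2d+1,q) (ε=2).
data PolarType : Set where
  Qplus Hodd Qpar W Heven Qminus : PolarType

-- A polar space is given by its type t and a prime power ρ; its order is
-- q = ρ² for the Hermitian types (q must be a square there) and q = ρ otherwise.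
IsPrimePower : ℕ → Set
IsPrimePower n = Σ ℕ λ p → Σ ℕ λ k → Prime p × (n ≡ p ℕ.^ suc k)

order : PolarType → ℕ → ℕ
order Hodd  ρ = ρ ℕ.* ρ
order Heven ρ = ρ ℕ.* ρ
order _     ρ = ρ

-- q^(k ε), exact natural number (ε may be half-integral; then q = ρ²).
qε : PolarType → ℕ → ℕ → ℕ
qε Qplus  ρ k = 1
qε Hodd   ρ k = ρ ℕ.^ k            -- (ρ²)^(k/2)
qε Qpar   ρ k = ρ ℕ.^ k
qε W      ρ k = ρ ℕ.^ k
qε Heven  ρ k = ρ ℕ.^ (3 ℕ.* k)    -- (ρ²)^(3k/2)
qε Qminus ρ k = ρ ℕ.^ (2 ℕ.* k)

choose2 : ℕ → ℕ
choose2 m = m C 2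

prod1 : ℕ → (ℕ → ℕ) → ℕ
prod1 zero    f = 1
prod1 (suc k) f = prod1 k f ℕ.* f (suc k)

divℕ : ℕ → ℕ → ℕ
divℕ m zero    = 0
divℕ m (suc n) = m ℕ./ suc n

gauss : ℕ → ℕ → ℕ → ℕ
gauss q n k with k ℕ.≤ᵇ n
... | true  = divℕ (prod1 k (λ i → q ℕ.^ (suc n ∸ i) ∸ 1)) (prod1 k (λ i → q ℕ.^ i ∸ 1))
... | false = 0

-- Σ_{t=lo}^{hi} f t (empty if lo > hi)
sumRange : ℕ → ℕ → (ℕ → ℤ) → ℤ
sumRange lo hi f = foldr ℤ._+_ (+ 0) (map (λ i → f (lo ℕ.+ i)) (upTo (suc hi ∸ lo)))

sgn : ℕ → ℤ
sgn k = (- (+ 1)) ℤ.^ k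

P : PolarType → ℕ → ℕ → ℕ → ℕ → ℤ
P t ρ d r s = sumRange (r ∸ s) ((d ∸ s) ⊓ r) λ u →
  sgn (r ∸ u) ℤ.* (+ (gauss q (d ∸ r) (d ∸ s ∸ u) ℕ.* gauss q r u
     ℕ.* q ℕ.^ (choose2 (r ∸ u) ℕ.+ choose2 (s ℕ.+ u ∸ r)) ℕ.* qε t ρ (s ℕ.+ u ∸ r)))
  where q = order t ρ

lam : PolarType → ℕ → ℕ → ℕ → ℕ → ℤ
lam t ρ d r a = sumRange 0 a λ s → P t ρ d r (d ∸ s)

Aterm : PolarType → ℕ → ℕ → ℕ → ℕ → ℕ → ℕ
Aterm t ρ d r s a =
  gauss q (d ∸ r) s ℕ.* q ℕ.^ choose2 (d ∸ r ∸ s) ℕ.* qε t ρ (d ∸ r ∸ s)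
  ℕ.* gauss q (r ∸ 1) (a ∸ s) ℕ.* q ℕ.^ choose2 (r ℕ.+ s ∸ a)
  where q = order t ρ

-- Each eigenvalue P_{r,d−s} is a convolution Σ_u εTerm(d−r, s−u) · altTerm(r, u), where
-- εTerm(n, j) = [n j] q^(C(n−j,2)+(n−j)ε) and altTerm(r, u) = (−1)^(r−u) [r u] q^C(r−u,2).
-- Summing over s ≤ a and exchanging the sums leaves prefix sums of altTerm(r, ·), which telescope by
-- the second q-Pascal rule to (−1)^(r−m) [r−1 m] q^C(r−m,2) when r > 0 and are identically 1 when r = 0.
module Submission where

open import Defs
open import Data.Bool using (true; false; T)
open import Data.Empty using (⊥-elim)
open import Data.Integer as ℤ using (ℤ; +_; -_) renaming (_+_ to _+ℤ_; _*_ to _*ℤ_)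
import Data.Integer.Properties as ℤₚ
open import Algebra.Properties.CommutativeSemigroup ℤₚ.*-commutativeSemigroup using (x∙yz≈y∙xz)
import Data.Integer.Tactic.RingSolver as ℤ-Solver
open import Data.List using (foldr; map; applyUpTo)
open import Data.Nat as ℕ using (ℕ; zero; suc; _+_; _*_; _^_; _∸_; _≤_; _<_; _⊓_; z≤n; s≤s; _≤?_)
open import Data.Nat.Combinatorics using (_C_; nC1≡n; nCk+nC[k+1]≡[n+1]C[k+1])
open import Data.Nat.DivMod using (m*n/n≡m)
open import Data.Nat.Primality using (prime⇒nonTrivial)
import Data.Nat.Properties as ℕₚ
import Data.Nat.Tactic.RingSolver as ℕ-Solver
open import Data.Product using (_×_; _,_)
open import Data.Sum using (inj₁; inj₂)
open import Relation.Nullary using (yes; no)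
open import Relation.Binary.PropositionalEquality

open ≡-Reasoning

-- Finite sums over initial segments of ℕ

∑ : ℕ → (ℕ → ℤ) → ℤ
∑ zero    f = + 0
∑ (suc n) f = f 0 +ℤ ∑ n (λ i → f (suc i))

foldr-map-applyUpTo : ∀ n (f : ℕ → ℤ) g → foldr _+ℤ_ (+ 0) (map f (applyUpTo g n)) ≡ ∑ n (λ i → f (g i))
foldr-map-applyUpTo zero    f g = refl
foldr-map-applyUpTo (suc n) f g = cong (f (g 0) +ℤ_) (foldr-map-applyUpTo n f (λ i → g (suc i)))

sumRange≡∑ : ∀ lo hi f → sumRange lo hi f ≡ ∑ (suc hi ∸ lo) (λ i → f (lo + i))
sumRange≡∑ lo hi f = foldr-map-applyUpTo (suc hi ∸ lo) (λ i → f (lo + i)) (λ i → i)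

∑-cong : ∀ n {f g : ℕ → ℤ} → (∀ i → i < n → f i ≡ g i) → ∑ n f ≡ ∑ n g
∑-cong zero    f≗g = refl
∑-cong (suc n) f≗g = cong₂ _+ℤ_ (f≗g 0 (s≤s z≤n)) (∑-cong n (λ i i<n → f≗g (suc i) (s≤s i<n)))

∑-≡0 : ∀ n {f : ℕ → ℤ} → (∀ i → i < n → f i ≡ + 0) → ∑ n f ≡ + 0
∑-≡0 zero    f≡0 = refl
∑-≡0 (suc n) f≡0 = cong₂ _+ℤ_ (f≡0 0 (s≤s z≤n)) (∑-≡0 n (λ i i<n → f≡0 (suc i) (s≤s i<n)))

∑-last : ∀ n f → ∑ (suc n) f ≡ ∑ n f +ℤ f n
∑-last zero    f = ℤₚ.+-comm (f 0) (+ 0)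
∑-last (suc n) f = trans (cong (f 0 +ℤ_) (∑-last n (λ i → f (suc i)))) (sym (ℤₚ.+-assoc (f 0) _ _))

∑-distribˡ : ∀ n c f → c *ℤ ∑ n f ≡ ∑ n (λ i → c *ℤ f i)
∑-distribˡ zero    c f = ℤₚ.*-zeroʳ c
∑-distribˡ (suc n) c f =
  trans (ℤₚ.*-distribˡ-+ c (f 0) _) (cong (c *ℤ f 0 +ℤ_) (∑-distribˡ n c (λ i → f (suc i))))

∑-distrib-+ : ∀ n f g → ∑ n (λ i → f i +ℤ g i) ≡ ∑ n f +ℤ ∑ n g
∑-distrib-+ zero    f g = refl
∑-distrib-+ (suc n) f g =
  trans (cong (f 0 +ℤ g 0 +ℤ_) (∑-distrib-+ n (λ i → f (suc i)) (λ i → g (suc i)))) (swap (f 0) (g 0) _ _)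
  where
  swap : ∀ a b c d → (a +ℤ b) +ℤ (c +ℤ d) ≡ (a +ℤ c) +ℤ (b +ℤ d)
  swap = ℤ-Solver.solve-∀

∑-reverse : ∀ m f → ∑ (suc m) f ≡ ∑ (suc m) (λ i → f (m ∸ i))
∑-reverse zero    f = refl
∑-reverse (suc m) f = begin
  f 0 +ℤ ∑ (suc m) (λ i → f (suc i))
    ≡⟨ cong (f 0 +ℤ_) (∑-reverse m (λ i → f (suc i))) ⟩
  f 0 +ℤ ∑ (suc m) (λ i → f (suc (m ∸ i)))
    ≡⟨ cong (f 0 +ℤ_) (∑-cong (suc m) (λ i i≤m → cong f (sym (ℕₚ.+-∸-assoc 1 (ℕₚ.≤-pred i≤m))))) ⟩
  f 0 +ℤ ∑ (suc m) (λ i → f (suc m ∸ i))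
    ≡⟨ ℤₚ.+-comm (f 0) _ ⟩
  ∑ (suc m) (λ i → f (suc m ∸ i)) +ℤ f 0
    ≡⟨ cong (λ k → ∑ (suc m) (λ i → f (suc m ∸ i)) +ℤ f k) (sym (ℕₚ.n∸n≡0 m)) ⟩
  ∑ (suc m) (λ i → f (suc m ∸ i)) +ℤ f (suc m ∸ suc m)
    ≡⟨ sym (∑-last (suc m) (λ i → f (suc m ∸ i))) ⟩
  ∑ (suc (suc m)) (λ i → f (suc m ∸ i)) ∎

∑-support : ∀ lo hi N f → hi ≤ N →
  (∀ i → i < lo → i ≤ N → f i ≡ + 0) → (∀ i → hi < i → i ≤ N → f i ≡ + 0) →
  ∑ (suc hi ∸ lo) (λ i → f (lo + i)) ≡ ∑ (suc N) f
∑-support zero zero N f _ _ above =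
  cong (f 0 +ℤ_) (sym (∑-≡0 N (λ i i<N → above (suc i) (s≤s z≤n) i<N)))
∑-support zero (suc hi) (suc N) f (s≤s hi≤N) _ above =
  cong (f 0 +ℤ_) (∑-support zero hi N (λ i → f (suc i)) hi≤N (λ _ ())
    (λ i hi<i i≤N → above (suc i) (s≤s hi<i) (s≤s i≤N)))
∑-support (suc lo) zero N f _ below above =
  trans (cong (λ n → ∑ n (λ i → f (suc lo + i))) (ℕₚ.0∸n≡0 lo)) (sym (∑-≡0 (suc N) vanish))
  where
  vanish : ∀ i → i < suc N → f i ≡ + 0
  vanish zero    _         = below 0 (s≤s z≤n) z≤n
  vanish (suc i) (s≤s i<N) = above (suc i) (s≤s z≤n) i<N
∑-support (suc lo) (suc hi) (suc N) f (s≤s hi≤N) below above = begin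
  ∑ (suc hi ∸ lo) (λ i → f (suc (lo + i)))
    ≡⟨ ∑-support lo hi N (λ i → f (suc i)) hi≤N
         (λ i i<lo i≤N → below (suc i) (s≤s i<lo) (s≤s i≤N))
         (λ i hi<i i≤N → above (suc i) (s≤s hi<i) (s≤s i≤N)) ⟩
  ∑ (suc N) (λ i → f (suc i))
    ≡⟨ sym (ℤₚ.+-identityˡ _) ⟩
  + 0 +ℤ ∑ (suc N) (λ i → f (suc i))
    ≡⟨ cong (_+ℤ ∑ (suc N) (λ i → f (suc i))) (sym (below 0 (s≤s z≤n) z≤n)) ⟩
  f 0 +ℤ ∑ (suc N) (λ i → f (suc i)) ∎

sumRange-support : ∀ lo hi N f → hi ≤ N →
  (∀ i → i < lo → i ≤ N → f i ≡ + 0) → (∀ i → hi < i → i ≤ N → f i ≡ + 0) →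
  sumRange lo hi f ≡ ∑ (suc N) f
sumRange-support lo hi N f hi≤N below above =
  trans (sumRange≡∑ lo hi f) (∑-support lo hi N f hi≤N below above)

∑-convolution : ∀ (f g : ℕ → ℤ) a →
  ∑ (suc a) (λ s → ∑ (suc s) (λ u → f (s ∸ u) *ℤ g u)) ≡ ∑ (suc a) (λ j → f j *ℤ ∑ (suc (a ∸ j)) g)
∑-convolution f g zero = regroup (f 0) (g 0)
  where
  regroup : ∀ x y → x *ℤ y +ℤ + 0 +ℤ + 0 ≡ x *ℤ (y +ℤ + 0) +ℤ + 0
  regroup = ℤ-Solver.solve-∀
∑-convolution f g (suc a) = begin
  ∑ (suc (suc a)) L
    ≡⟨ ∑-last (suc a) L ⟩
  ∑ (suc a) L +ℤ L (suc a)
    ≡⟨ cong₂ _+ℤ_ (∑-convolution f g a) flipped ⟩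
  ∑ (suc a) (R a) +ℤ ∑ (suc (suc a)) new
    ≡⟨ cong (∑ (suc a) (R a) +ℤ_) (∑-last (suc a) new) ⟩
  ∑ (suc a) (R a) +ℤ (∑ (suc a) new +ℤ new (suc a))
    ≡⟨ sym (ℤₚ.+-assoc (∑ (suc a) (R a)) _ _) ⟩
  ∑ (suc a) (R a) +ℤ ∑ (suc a) new +ℤ new (suc a)
    ≡⟨ cong₂ _+ℤ_ (sym (∑-distrib-+ (suc a) (R a) new)) last ⟩
  ∑ (suc a) (λ j → R a j +ℤ new j) +ℤ R (suc a) (suc a)
    ≡⟨ cong (_+ℤ R (suc a) (suc a)) (∑-cong (suc a) (λ j j≤a → extend (ℕₚ.≤-pred j≤a))) ⟩
  ∑ (suc a) (R (suc a)) +ℤ R (suc a) (suc a)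
    ≡⟨ sym (∑-last (suc a) (R (suc a))) ⟩
  ∑ (suc (suc a)) (R (suc a)) ∎
  where
  L : ℕ → ℤ
  L s = ∑ (suc s) (λ u → f (s ∸ u) *ℤ g u)
  R : ℕ → ℕ → ℤ
  R b j = f j *ℤ ∑ (suc (b ∸ j)) g
  new : ℕ → ℤ
  new j = f j *ℤ g (suc a ∸ j)
  flipped : L (suc a) ≡ ∑ (suc (suc a)) new
  flipped = trans (∑-reverse (suc a) (λ u → f (suc a ∸ u) *ℤ g u))
    (∑-cong (suc (suc a)) (λ j j≤1+a → cong (λ i → f i *ℤ g (suc a ∸ j)) (ℕₚ.m∸[m∸n]≡n (ℕₚ.≤-pred j≤1+a))))
  last : new (suc a) ≡ R (suc a) (suc a)
  last = begin
    f (suc a) *ℤ g (a ∸ a)          ≡⟨ cong (λ k → f (suc a) *ℤ g k) (ℕₚ.n∸n≡0 a) ⟩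
    f (suc a) *ℤ g 0                ≡⟨ cong (f (suc a) *ℤ_) (sym (ℤₚ.+-identityʳ (g 0))) ⟩
    f (suc a) *ℤ ∑ 1 g              ≡⟨ cong (λ k → f (suc a) *ℤ ∑ (suc k) g) (sym (ℕₚ.n∸n≡0 a)) ⟩
    R (suc a) (suc a)               ∎
  extend : ∀ {j} → j ≤ a → R a j +ℤ new j ≡ R (suc a) j
  extend {j} j≤a rewrite ℕₚ.+-∸-assoc 1 j≤a =
    trans (sym (ℤₚ.*-distribˡ-+ (f j) _ _)) (cong (f j *ℤ_) (sym (∑-last (suc (a ∸ j)) g)))

∑-telescope : ∀ (f F : ℕ → ℤ) → f 0 ≡ F 0 → (∀ m → F m +ℤ f (suc m) ≡ F (suc m)) →
  ∀ m → ∑ (suc m) f ≡ F m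
∑-telescope f F base step zero    = trans (ℤₚ.+-identityʳ (f 0)) base
∑-telescope f F base step (suc m) =
  trans (∑-last (suc m) f) (trans (cong (_+ℤ f (suc m)) (∑-telescope f F base step m)) (step m))

-- Gaussian coefficients

-- [n k]_q by the q-Pascal recursion, which sidesteps the truncated division in gauss.
qbinom : ℕ → ℕ → ℕ → ℕ
qbinom q n       zero    = 1
qbinom q zero    (suc k) = 0
qbinom q (suc n) (suc k) = qbinom q n k + q ^ suc k * qbinom q n (suc k)

k>n⇒qbinom≡0 : ∀ q {n k} → n < k → qbinom q n k ≡ 0
k>n⇒qbinom≡0 q {zero}  {suc k} _ = refl
k>n⇒qbinom≡0 q {suc n} {suc k} (s≤s n<k)
  rewrite k>n⇒qbinom≡0 q n<k | k>n⇒qbinom≡0 q (ℕₚ.m<n⇒m<1+n n<k) = ℕₚ.*-zeroʳ (q ^ suc k)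

k>n⇒gauss≡0 : ∀ q {n k} → n < k → gauss q n k ≡ 0
k>n⇒gauss≡0 q {n} {k} n<k with k ℕ.≤ᵇ n in k≤ᵇn
... | false = refl
... | true  = ⊥-elim (ℕₚ.<⇒≱ n<k (ℕₚ.≤ᵇ⇒≤ k n (subst T (sym k≤ᵇn) _)))

gaussNumerator : ℕ → ℕ → ℕ → ℕ
gaussNumerator q n k = prod1 k (λ i → q ^ (suc n ∸ i) ∸ 1)

gaussDenominator : ℕ → ℕ → ℕ
gaussDenominator q k = prod1 k (λ i → q ^ i ∸ 1)

prod1-head : ∀ k f → prod1 (suc k) f ≡ f 1 * prod1 k (λ i → f (suc i))
prod1-head zero    f = ℕₚ.*-comm 1 (f 1)
prod1-head (suc k) f = trans (cong (_* f (suc (suc k))) (prod1-head k f)) (ℕₚ.*-assoc (f 1) _ _)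

prod1-pos : ∀ k f → (∀ i → 1 ≤ f (suc i)) → 1 ≤ prod1 k f
prod1-pos zero    f f-pos = s≤s z≤n
prod1-pos (suc k) f f-pos = ℕₚ.*-mono-≤ (prod1-pos k f f-pos) (f-pos k)

1≤m^n : ∀ {m} n → 1 ≤ m → 1 ≤ m ^ n
1≤m^n {suc m} n _ = ℕₚ.m^n>0 (suc m) n

2≤m^[1+n] : ∀ {m} n → 2 ≤ m → 2 ≤ m ^ suc n
2≤m^[1+n] {m} n m≥2 =
  ℕₚ.*-mono-≤ m≥2 (1≤m^n n (ℕₚ.≤-trans (s≤s z≤n) m≥2))

gaussDenominator-pos : ∀ {q} → 2 ≤ q → ∀ k → 1 ≤ gaussDenominator q k
gaussDenominator-pos q≥2 k = prod1-pos k _ (λ i → ℕₚ.∸-monoˡ-≤ 1 (2≤m^[1+n] i q≥2))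

[a∸1]+a*[b∸1]≡a*b∸1 : ∀ {a b} → 1 ≤ a → 1 ≤ b → (a ∸ 1) + a * (b ∸ 1) ≡ a * b ∸ 1
[a∸1]+a*[b∸1]≡a*b∸1 {suc a} {suc b} _ _ = identity a b
  where
  identity : ∀ a b → a + suc a * b ≡ b + a * suc b
  identity = ℕ-Solver.solve-∀

gaussNumerator-suc : ∀ q n k → gaussNumerator q (suc n) (suc k) ≡ (q ^ suc n ∸ 1) * gaussNumerator q n k
gaussNumerator-suc q n k = prod1-head k (λ i → q ^ (suc (suc n) ∸ i) ∸ 1)

mutual
  qbinom*den≡num : ∀ {q} → 1 ≤ q → ∀ {n k} → k ≤ n →
    qbinom q n k * gaussDenominator q k ≡ gaussNumerator q n k
  qbinom*den≡num q≥1 {n} {zero} _ = refl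
  qbinom*den≡num {q} q≥1 {suc n} {suc k} (s≤s k≤n) = begin
    (qbinom q n k + Q * qbinom q n (suc k)) * (D * (Q ∸ 1))
      ≡⟨ distribute (qbinom q n k) Q (qbinom q n (suc k)) D (Q ∸ 1) ⟩
    qbinom q n k * D * (Q ∸ 1) + Q * (qbinom q n (suc k) * (D * (Q ∸ 1)))
      ≡⟨ cong₂ (λ x y → x * (Q ∸ 1) + Q * y) (qbinom*den≡num q≥1 k≤n) (qbinom[1+k]*den≡num q≥1 k≤n) ⟩
    N * (Q ∸ 1) + Q * (N * (q ^ (n ∸ k) ∸ 1))
      ≡⟨ factor N (Q ∸ 1) Q (q ^ (n ∸ k) ∸ 1) ⟩
    N * ((Q ∸ 1) + Q * (q ^ (n ∸ k) ∸ 1))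
      ≡⟨ cong (N *_) ([a∸1]+a*[b∸1]≡a*b∸1 (1≤m^n (suc k) q≥1) (1≤m^n (n ∸ k) q≥1)) ⟩
    N * (Q * q ^ (n ∸ k) ∸ 1)
      ≡⟨ cong (λ e → N * (e ∸ 1)) (sym (ℕₚ.^-distribˡ-+-* q (suc k) (n ∸ k))) ⟩
    N * (q ^ (suc k + (n ∸ k)) ∸ 1)
      ≡⟨ cong (λ e → N * (q ^ suc e ∸ 1)) (ℕₚ.m+[n∸m]≡n k≤n) ⟩
    N * (q ^ suc n ∸ 1)
      ≡⟨ trans (ℕₚ.*-comm N _) (sym (gaussNumerator-suc q n k)) ⟩
    gaussNumerator q (suc n) (suc k) ∎
    where
    Q = q ^ suc k
    D = gaussDenominator q k
    N = gaussNumerator q n k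
    distribute : ∀ a b c d e → (a + b * c) * (d * e) ≡ a * d * e + b * (c * (d * e))
    distribute = ℕ-Solver.solve-∀
    factor : ∀ a e b c → a * e + b * (a * c) ≡ a * (e + b * c)
    factor = ℕ-Solver.solve-∀

  qbinom[1+k]*den≡num : ∀ {q} → 1 ≤ q → ∀ {n k} → k ≤ n →
    qbinom q n (suc k) * gaussDenominator q (suc k) ≡ gaussNumerator q n k * (q ^ (n ∸ k) ∸ 1)
  qbinom[1+k]*den≡num q≥1 k≤n with ℕₚ.m≤n⇒m<n∨m≡n k≤n
  ... | inj₁ k<n = qbinom*den≡num q≥1 k<n
  qbinom[1+k]*den≡num {q} q≥1 {k = k} _ | inj₂ refl
    rewrite k>n⇒qbinom≡0 q (ℕₚ.n<1+n k) | ℕₚ.n∸n≡0 k = sym (ℕₚ.*-zeroʳ (gaussNumerator q k k))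

divℕ-* : ∀ m {n} → 1 ≤ n → divℕ (m * n) n ≡ m
divℕ-* m {suc n} _ = m*n/n≡m m (suc n)

gauss≡qbinom : ∀ {q} → 2 ≤ q → ∀ n k → gauss q n k ≡ qbinom q n k
gauss≡qbinom {q} q≥2 n k with k ℕ.≤ᵇ n in k≤ᵇn
... | true = begin
  divℕ (gaussNumerator q n k) (gaussDenominator q k)
    ≡⟨ cong (λ x → divℕ x (gaussDenominator q k)) (sym (qbinom*den≡num (ℕₚ.≤-trans (s≤s z≤n) q≥2) k≤n)) ⟩
  divℕ (qbinom q n k * gaussDenominator q k) (gaussDenominator q k)
    ≡⟨ divℕ-* (qbinom q n k) (gaussDenominator-pos q≥2 k) ⟩
  qbinom q n k ∎
  where
  k≤n : k ≤ n
  k≤n = ℕₚ.≤ᵇ⇒≤ k n (subst T (sym k≤ᵇn) _)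
... | false = sym (k>n⇒qbinom≡0 q {n} {k} (ℕₚ.≰⇒> (λ k≤n → subst T k≤ᵇn (ℕₚ.≤⇒≤ᵇ k≤n))))

qbinom-pascal′ : ∀ {q} → 2 ≤ q → ∀ n k →
  qbinom q (suc n) (suc k) ≡ qbinom q n (suc k) + q ^ (n ∸ k) * qbinom q n k
qbinom-pascal′ {q} q≥2 n k with k ≤? n
... | no k≰n = begin
  qbinom q (suc n) (suc k)                          ≡⟨ k>n⇒qbinom≡0 q (s≤s n<k) ⟩
  0                                                 ≡⟨ sym (ℕₚ.*-zeroʳ (q ^ (n ∸ k))) ⟩
  q ^ (n ∸ k) * 0                                   ≡⟨ cong₂ (λ x y → x + q ^ (n ∸ k) * y)
                                                         (sym (k>n⇒qbinom≡0 q (ℕₚ.m<n⇒m<1+n n<k)))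
                                                         (sym (k>n⇒qbinom≡0 q n<k)) ⟩
  qbinom q n (suc k) + q ^ (n ∸ k) * qbinom q n k   ∎
  where n<k = ℕₚ.≰⇒> k≰n
... | yes k≤n = ℕₚ.*-cancelʳ-≡ _ _ (gaussDenominator q (suc k)) {{ℕ.>-nonZero (gaussDenominator-pos q≥2 (suc k))}} (begin
  qbinom q (suc n) (suc k) * gaussDenominator q (suc k)
    ≡⟨ qbinom*den≡num q≥1 (s≤s k≤n) ⟩
  gaussNumerator q (suc n) (suc k)
    ≡⟨ gaussNumerator-suc q n k ⟩
  (q ^ suc n ∸ 1) * N
    ≡⟨ cong (λ e → (q ^ e ∸ 1) * N) (sym (trans (ℕₚ.+-suc (n ∸ k) k) (cong suc (ℕₚ.m∸n+n≡m k≤n)))) ⟩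
  (q ^ ((n ∸ k) + suc k) ∸ 1) * N
    ≡⟨ cong (λ e → (e ∸ 1) * N) (ℕₚ.^-distribˡ-+-* q (n ∸ k) (suc k)) ⟩
  (X * Q ∸ 1) * N
    ≡⟨ cong (_* N) (sym ([a∸1]+a*[b∸1]≡a*b∸1 (1≤m^n (n ∸ k) q≥1) (1≤m^n (suc k) q≥1))) ⟩
  ((X ∸ 1) + X * (Q ∸ 1)) * N
    ≡⟨ distribute (X ∸ 1) X (Q ∸ 1) N ⟩
  N * (X ∸ 1) + X * (N * (Q ∸ 1))
    ≡⟨ cong₂ (λ x y → x + X * y) (sym (qbinom[1+k]*den≡num q≥1 k≤n))
                                 (cong (_* (Q ∸ 1)) (sym (qbinom*den≡num q≥1 k≤n))) ⟩
  qbinom q n (suc k) * (D * (Q ∸ 1)) + X * (qbinom q n k * D * (Q ∸ 1))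
    ≡⟨ factor (qbinom q n (suc k)) D (Q ∸ 1) X (qbinom q n k) ⟩
  (qbinom q n (suc k) + X * qbinom q n k) * gaussDenominator q (suc k) ∎)
  where
  q≥1 = ℕₚ.≤-trans (s≤s z≤n) q≥2
  X = q ^ (n ∸ k)
  Q = q ^ suc k
  D = gaussDenominator q k
  N = gaussNumerator q n k
  distribute : ∀ a x e n → (a + x * e) * n ≡ n * a + x * (n * e)
  distribute = ℕ-Solver.solve-∀
  factor : ∀ g d e x h → g * (d * e) + x * (h * d * e) ≡ (g + x * h) * (d * e)
  factor = ℕ-Solver.solve-∀

-- Index arithmetic and signs

m∸n+o≡m∸[n∸o] : ∀ {m n o} → o ≤ n → n ≤ m → m ∸ n + o ≡ m ∸ (n ∸ o)
m∸n+o≡m∸[n∸o] {m} {n} {o} o≤n n≤m = sym (begin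
  m ∸ (n ∸ o)                          ≡⟨ cong (_∸ (n ∸ o)) (sym whole) ⟩
  (m ∸ n + o) + (n ∸ o) ∸ (n ∸ o)      ≡⟨ ℕₚ.m+n∸n≡m (m ∸ n + o) (n ∸ o) ⟩
  m ∸ n + o                            ∎)
  where
  whole : m ∸ n + o + (n ∸ o) ≡ m
  whole = trans (ℕₚ.+-assoc (m ∸ n) o _) (trans (cong (λ z → m ∸ n + z) (ℕₚ.m+[n∸m]≡n o≤n)) (ℕₚ.m∸n+n≡m n≤m))

m∸n+o∸p≡m∸p∸[n∸o] : ∀ {m n o} p → o ≤ n → n ≤ m → m ∸ n + o ∸ p ≡ m ∸ p ∸ (n ∸ o)
m∸n+o∸p≡m∸p∸[n∸o] {m} {n} {o} p o≤n n≤m = begin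
  m ∸ n + o ∸ p          ≡⟨ cong (_∸ p) (m∸n+o≡m∸[n∸o] o≤n n≤m) ⟩
  m ∸ (n ∸ o) ∸ p        ≡⟨ ℕₚ.∸-+-assoc m (n ∸ o) p ⟩
  m ∸ ((n ∸ o) + p)      ≡⟨ cong (m ∸_) (ℕₚ.+-comm (n ∸ o) p) ⟩
  m ∸ (p + (n ∸ o))      ≡⟨ sym (ℕₚ.∸-+-assoc m p (n ∸ o)) ⟩
  m ∸ p ∸ (n ∸ o)        ∎

m+n∸o≡m∸[o∸n] : ∀ m {n o} → n ≤ o → m + n ∸ o ≡ m ∸ (o ∸ n)
m+n∸o≡m∸[o∸n] m {n} {o} n≤o =
  trans (cong₂ _∸_ (ℕₚ.+-comm m n) (sym (ℕₚ.m+[n∸m]≡n n≤o))) (ℕₚ.[m+n]∸[m+o]≡n∸o n m (o ∸ n))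

m<n∸o⇒o<n∸m : ∀ {m n o} → m < n ∸ o → o < n ∸ m
m<n∸o⇒o<n∸m {m} {n}     {zero}  m<n   = ℕₚ.m<n⇒0<n∸m m<n
m<n∸o⇒o<n∸m {m} {suc n} {suc o} m<n∸o =
  subst (suc o <_) (sym (ℕₚ.+-∸-assoc 1 m≤n)) (s≤s (m<n∸o⇒o<n∸m m<n∸o))
  where m≤n = ℕₚ.≤-trans (ℕₚ.<⇒≤ m<n∸o) (ℕₚ.m∸n≤m n o)

sgn-+ : ∀ m n → sgn (m + n) ≡ sgn m *ℤ sgn n
sgn-+ = ℤₚ.^-distribˡ-+-* (- (+ 1))

sgn-double : ∀ n → sgn (n + n) ≡ + 1
sgn-double zero = refl
sgn-double (suc n) rewrite ℕₚ.+-suc n n = trans (negate-twice (sgn (n + n))) (sgn-double n)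
  where
  negate-twice : ∀ x → - (+ 1) *ℤ (- (+ 1) *ℤ x) ≡ x
  negate-twice = ℤ-Solver.solve-∀

sgn[m∸[n∸k]] : ∀ {m n k} → k ≤ n → n ∸ k ≤ m → sgn (m ∸ (n ∸ k)) ≡ sgn (m + n) *ℤ sgn k
sgn[m∸[n∸k]] {m} {n} {k} k≤n n∸k≤m = begin
  sgn x                          ≡⟨ sym (ℤₚ.*-identityʳ (sgn x)) ⟩
  sgn x *ℤ + 1                   ≡⟨ cong (sgn x *ℤ_) (sym (sgn-double n)) ⟩
  sgn x *ℤ sgn (n + n)           ≡⟨ sym (sgn-+ x (n + n)) ⟩
  sgn (x + (n + n))              ≡⟨ cong (λ z → sgn (x + (z + n))) (sym (ℕₚ.m∸n+n≡m k≤n)) ⟩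
  sgn (x + ((n ∸ k) + k + n))    ≡⟨ cong sgn (rearrange x (n ∸ k) k n) ⟩
  sgn (x + (n ∸ k) + n + k)      ≡⟨ cong (λ z → sgn (z + n + k)) (ℕₚ.m∸n+n≡m n∸k≤m) ⟩
  sgn (m + n + k)                ≡⟨ sgn-+ (m + n) k ⟩
  sgn (m + n) *ℤ sgn k           ∎
  where
  x = m ∸ (n ∸ k)
  rearrange : ∀ x y k n → x + (y + k + n) ≡ x + y + n + k
  rearrange = ℕ-Solver.solve-∀

choose2-suc : ∀ x → choose2 (suc x) ≡ choose2 x + x
choose2-suc x = begin
  suc x C 2          ≡⟨ sym (nCk+nC[k+1]≡[n+1]C[k+1] x 1) ⟩
  x C 1 + x C 2      ≡⟨ cong (_+ x C 2) (nC1≡n x) ⟩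
  x + x C 2          ≡⟨ ℕₚ.+-comm x (x C 2) ⟩
  choose2 x + x      ∎

-- P, lam and Aterm with q and E k = q^(kε) abstracted; at q = order t ρ, E = qε t ρ they agree definitionally.

P′-summand : ℕ → (ℕ → ℕ) → ℕ → ℕ → ℕ → ℕ → ℤ
P′-summand q E d r s u = sgn (r ∸ u) *ℤ (+ (gauss q (d ∸ r) (d ∸ s ∸ u) * gauss q r u
  * q ^ (choose2 (r ∸ u) + choose2 (s + u ∸ r)) * E (s + u ∸ r)))

P′ : ℕ → (ℕ → ℕ) → ℕ → ℕ → ℕ → ℤ
P′ q E d r s = sumRange (r ∸ s) ((d ∸ s) ⊓ r) (P′-summand q E d r s)

lam′ : ℕ → (ℕ → ℕ) → ℕ → ℕ → ℕ → ℤ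
lam′ q E d r a = sumRange 0 a (λ s → P′ q E d r (d ∸ s))

Aterm′ : ℕ → (ℕ → ℕ) → ℕ → ℕ → ℕ → ℕ → ℕ
Aterm′ q E d r s a = gauss q (d ∸ r) s * q ^ choose2 (d ∸ r ∸ s) * E (d ∸ r ∸ s)
  * gauss q (r ∸ 1) (a ∸ s) * q ^ choose2 (r + s ∸ a)

εTerm : ℕ → (ℕ → ℕ) → ℕ → ℕ → ℕ
εTerm q E n j = qbinom q n j * q ^ choose2 (n ∸ j) * E (n ∸ j)

altTerm : ℕ → ℕ → ℕ → ℤ
altTerm q r u = sgn (r ∸ u) *ℤ + (qbinom q r u * q ^ choose2 (r ∸ u))

altPrefix : ℕ → ℕ → ℕ → ℤ
altPrefix q r m = sgn (suc r ∸ m) *ℤ + (qbinom q r m * q ^ choose2 (suc r ∸ m))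

εTerm-above : ∀ q E {n j} → n < j → εTerm q E n j ≡ 0
εTerm-above q E n<j rewrite k>n⇒qbinom≡0 q n<j = refl

altTerm-above : ∀ q {r u} → r < u → altTerm q r u ≡ + 0
altTerm-above q {r} {u} r<u rewrite k>n⇒qbinom≡0 q r<u = ℤₚ.*-zeroʳ (sgn (r ∸ u))

altPrefix-above : ∀ q {r m} → r < m → altPrefix q r m ≡ + 0
altPrefix-above q {r} {m} r<m rewrite k>n⇒qbinom≡0 q r<m = ℤₚ.*-zeroʳ (sgn (suc r ∸ m))

∑-altTerm₀ : ∀ q m → ∑ (suc m) (altTerm q 0) ≡ + 1
∑-altTerm₀ q m = cong (+ 1 +ℤ_) (∑-≡0 m (λ _ _ → refl))

Aterm′-below : ∀ q E {d r a j} → j < a ∸ r → Aterm′ q E d (suc r) j a ≡ 0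
Aterm′-below q E {d} {r} {a} {j} j<a∸r
  rewrite k>n⇒gauss≡0 q {suc r ∸ 1} {a ∸ j} (m<n∸o⇒o<n∸m j<a∸r) =
  cong (_* q ^ choose2 (suc r + j ∸ a)) (ℕₚ.*-zeroʳ (gauss q (d ∸ suc r) j * q ^ choose2 (d ∸ suc r ∸ j) * E (d ∸ suc r ∸ j)))

Aterm′-above : ∀ q E {d r a j} → d ∸ r < j → Aterm′ q E d r j a ≡ 0
Aterm′-above q E n<j rewrite k>n⇒gauss≡0 q n<j = refl

alternating-step : ∀ q x g g′ →
  sgn (suc x) *ℤ + (g * q ^ choose2 (suc x)) +ℤ sgn x *ℤ + ((g′ + q ^ x * g) * q ^ choose2 x)
    ≡ sgn x *ℤ + (g′ * q ^ choose2 x)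
alternating-step q x g g′ = begin
  sgn (suc x) *ℤ + (g * q ^ choose2 (suc x)) +ℤ sgn x *ℤ + ((g′ + B * g) * A)
    ≡⟨ cong (λ e → sgn (suc x) *ℤ + (g * q ^ e) +ℤ sgn x *ℤ + ((g′ + B * g) * A)) (choose2-suc x) ⟩
  sgn (suc x) *ℤ + (g * q ^ (choose2 x + x)) +ℤ sgn x *ℤ + ((g′ + B * g) * A)
    ≡⟨ cong₂ (λ y z → sgn (suc x) *ℤ y +ℤ sgn x *ℤ z) casts₁ casts₂ ⟩
  - (+ 1) *ℤ sgn x *ℤ (+ g *ℤ (+ A *ℤ + B)) +ℤ sgn x *ℤ ((+ g′ +ℤ + B *ℤ + g) *ℤ + A)
    ≡⟨ cancel (sgn x) (+ g) (+ g′) (+ A) (+ B) ⟩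
  sgn x *ℤ (+ g′ *ℤ + A)
    ≡⟨ cong (sgn x *ℤ_) (sym (ℤₚ.pos-* g′ A)) ⟩
  sgn x *ℤ + (g′ * A) ∎
  where
  A = q ^ choose2 x
  B = q ^ x
  casts₁ : + (g * q ^ (choose2 x + x)) ≡ + g *ℤ (+ A *ℤ + B)
  casts₁ = begin
    + (g * q ^ (choose2 x + x))  ≡⟨ cong (λ e → + (g * e)) (ℕₚ.^-distribˡ-+-* q (choose2 x) x) ⟩
    + (g * (A * B))              ≡⟨ ℤₚ.pos-* g (A * B) ⟩
    + g *ℤ + (A * B)             ≡⟨ cong (+ g *ℤ_) (ℤₚ.pos-* A B) ⟩
    + g *ℤ (+ A *ℤ + B)          ∎
  casts₂ : + ((g′ + B * g) * A) ≡ (+ g′ +ℤ + B *ℤ + g) *ℤ + A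
  casts₂ = begin
    + ((g′ + B * g) * A)         ≡⟨ ℤₚ.pos-* (g′ + B * g) A ⟩
    + (g′ + B * g) *ℤ + A        ≡⟨ cong (_*ℤ + A) (ℤₚ.pos-+ g′ (B * g)) ⟩
    (+ g′ +ℤ + (B * g)) *ℤ + A   ≡⟨ cong (λ y → (+ g′ +ℤ y) *ℤ + A) (ℤₚ.pos-* B g) ⟩
    (+ g′ +ℤ + B *ℤ + g) *ℤ + A  ∎
  cancel : ∀ s g g′ A B →
    - (+ 1) *ℤ s *ℤ (g *ℤ (A *ℤ B)) +ℤ s *ℤ ((g′ +ℤ B *ℤ g) *ℤ A) ≡ s *ℤ (g′ *ℤ A)
  cancel = ℤ-Solver.solve-∀

module _ {q : ℕ} (q≥2 : 2 ≤ q) (E : ℕ → ℕ) where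

  altPrefix-step : ∀ r m → altPrefix q r m +ℤ altTerm q (suc r) (suc m) ≡ altPrefix q r (suc m)
  altPrefix-step r m with m ≤? r
  ... | yes m≤r rewrite ℕₚ.+-∸-assoc 1 m≤r | qbinom-pascal′ q≥2 r m =
    alternating-step q (r ∸ m) (qbinom q r m) (qbinom q r (suc m))
  ... | no m≰r = begin
    altPrefix q r m +ℤ altTerm q (suc r) (suc m)
      ≡⟨ cong₂ _+ℤ_ (altPrefix-above q r<m) (altTerm-above q (s≤s r<m)) ⟩
    + 0
      ≡⟨ sym (altPrefix-above q (ℕₚ.m<n⇒m<1+n r<m)) ⟩
    altPrefix q r (suc m) ∎
    where r<m = ℕₚ.≰⇒> m≰r

  ∑-altTerm : ∀ r m → ∑ (suc m) (altTerm q (suc r)) ≡ altPrefix q r m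
  ∑-altTerm r = ∑-telescope (altTerm q (suc r)) (altPrefix q r) refl (altPrefix-step r)

  P′-summand≡εTerm*altTerm : ∀ {d r s u} → u ≤ s → s ≤ d →
    P′-summand q E d r (d ∸ s) u ≡ + εTerm q E (d ∸ r) (s ∸ u) *ℤ altTerm q r u
  P′-summand≡εTerm*altTerm {d} {r} {s} {u} u≤s s≤d
    rewrite ℕₚ.m∸[m∸n]≡n s≤d | gauss≡qbinom q≥2 (d ∸ r) (s ∸ u) | gauss≡qbinom q≥2 r u
          | m∸n+o∸p≡m∸p∸[n∸o] r u≤s s≤d =
    regroup (sgn (r ∸ u)) (qbinom q (d ∸ r) (s ∸ u)) (qbinom q r u) (r ∸ u) (d ∸ r ∸ (s ∸ u))
    where
    regroup : ∀ σ g₁ g₂ x w →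
      σ *ℤ + (g₁ * g₂ * q ^ (choose2 x + choose2 w) * E w)
        ≡ + (g₁ * q ^ choose2 w * E w) *ℤ (σ *ℤ + (g₂ * q ^ choose2 x))
    regroup σ g₁ g₂ x w = begin
      σ *ℤ + (g₁ * g₂ * q ^ (choose2 x + choose2 w) * E w)
        ≡⟨ cong (λ e → σ *ℤ + (g₁ * g₂ * e * E w)) (ℕₚ.^-distribˡ-+-* q (choose2 x) (choose2 w)) ⟩
      σ *ℤ + (g₁ * g₂ * (qˣ * qʷ) * E w)
        ≡⟨ cong (λ n → σ *ℤ + n) (reorder g₁ g₂ qˣ qʷ (E w)) ⟩
      σ *ℤ + (g₁ * qʷ * E w * (g₂ * qˣ))
        ≡⟨ cong (σ *ℤ_) (ℤₚ.pos-* (g₁ * qʷ * E w) (g₂ * qˣ)) ⟩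
      σ *ℤ (+ (g₁ * qʷ * E w) *ℤ + (g₂ * qˣ))
        ≡⟨ x∙yz≈y∙xz σ (+ (g₁ * qʷ * E w)) (+ (g₂ * qˣ)) ⟩
      + (g₁ * qʷ * E w) *ℤ (σ *ℤ + (g₂ * qˣ)) ∎
      where
      qˣ = q ^ choose2 x
      qʷ = q ^ choose2 w
      reorder : ∀ g₁ g₂ a b e → g₁ * g₂ * (a * b) * e ≡ g₁ * b * e * (g₂ * a)
      reorder = ℕ-Solver.solve-∀

  P′-convolution : ∀ {d r s} → r ≤ d → s ≤ d →
    P′ q E d r (d ∸ s) ≡ ∑ (suc s) (λ u → + εTerm q E (d ∸ r) (s ∸ u) *ℤ altTerm q r u)
  P′-convolution {d} {r} {s} r≤d s≤d = begin
    P′ q E d r (d ∸ s)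
      ≡⟨ sumRange-support (r ∸ (d ∸ s)) ((d ∸ (d ∸ s)) ⊓ r) s F hi≤s below above ⟩
    ∑ (suc s) F
      ≡⟨ ∑-cong (suc s) (λ u u≤s → split (ℕₚ.≤-pred u≤s)) ⟩
    ∑ (suc s) (λ u → + εTerm q E (d ∸ r) (s ∸ u) *ℤ altTerm q r u) ∎
    where
    F = P′-summand q E d r (d ∸ s)
    split : ∀ {u} → u ≤ s → F u ≡ + εTerm q E (d ∸ r) (s ∸ u) *ℤ altTerm q r u
    split u≤s = P′-summand≡εTerm*altTerm u≤s s≤d
    d∸[d∸s]≡s : d ∸ (d ∸ s) ≡ s
    d∸[d∸s]≡s = ℕₚ.m∸[m∸n]≡n s≤d
    hi≤s : (d ∸ (d ∸ s)) ⊓ r ≤ s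
    hi≤s = ℕₚ.≤-trans (ℕₚ.m⊓n≤m _ r) (ℕₚ.≤-reflexive d∸[d∸s]≡s)
    lo≤ : ∀ {u} → u ≤ s → s ∸ u ≤ d ∸ r → r ∸ (d ∸ s) ≤ u
    lo≤ {u} u≤s s∸u≤d∸r = ℕₚ.m≤n+o⇒m∸n≤o r (d ∸ s)
      (ℕₚ.≤-trans (ℕₚ.≤-reflexive (sym (ℕₚ.m∸[m∸n]≡n r≤d)))
        (ℕₚ.≤-trans (ℕₚ.∸-monoʳ-≤ d s∸u≤d∸r) (ℕₚ.≤-reflexive (sym (m∸n+o≡m∸[n∸o] u≤s s≤d)))))
    below : ∀ u → u < r ∸ (d ∸ s) → u ≤ s → F u ≡ + 0
    below u u<lo u≤s = begin
      F u                                                 ≡⟨ split u≤s ⟩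
      + εTerm q E (d ∸ r) (s ∸ u) *ℤ altTerm q r u        ≡⟨ cong (λ n → + n *ℤ altTerm q r u) (εTerm-above q E d∸r<s∸u) ⟩
      + 0 *ℤ altTerm q r u                                ≡⟨ ℤₚ.*-zeroˡ (altTerm q r u) ⟩
      + 0                                                 ∎
      where d∸r<s∸u = ℕₚ.≰⇒> (λ s∸u≤d∸r → ℕₚ.<⇒≱ u<lo (lo≤ u≤s s∸u≤d∸r))
    above : ∀ u → (d ∸ (d ∸ s)) ⊓ r < u → u ≤ s → F u ≡ + 0
    above u hi<u u≤s = begin
      F u                                                 ≡⟨ split u≤s ⟩
      + εTerm q E (d ∸ r) (s ∸ u) *ℤ altTerm q r u        ≡⟨ cong (+ εTerm q E (d ∸ r) (s ∸ u) *ℤ_) (altTerm-above q r<u) ⟩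
      + εTerm q E (d ∸ r) (s ∸ u) *ℤ + 0                  ≡⟨ ℤₚ.*-zeroʳ (+ εTerm q E (d ∸ r) (s ∸ u)) ⟩
      + 0                                                 ∎
      where r<u = ℕₚ.≰⇒> (λ u≤r → ℕₚ.<⇒≱ hi<u (ℕₚ.⊓-glb (subst (u ≤_) (sym d∸[d∸s]≡s) u≤s) u≤r))

  lam′-convolution : ∀ {d r a} → r ≤ d → a ≤ d →
    lam′ q E d r a ≡ ∑ (suc a) (λ j → + εTerm q E (d ∸ r) j *ℤ ∑ (suc (a ∸ j)) (altTerm q r))
  lam′-convolution {d} {r} {a} r≤d a≤d = begin
    lam′ q E d r a
      ≡⟨ sumRange≡∑ 0 a (λ s → P′ q E d r (d ∸ s)) ⟩
    ∑ (suc a) (λ s → P′ q E d r (d ∸ s))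
      ≡⟨ ∑-cong (suc a) (λ s s≤a → P′-convolution r≤d (ℕₚ.≤-trans (ℕₚ.≤-pred s≤a) a≤d)) ⟩
    ∑ (suc a) (λ s → ∑ (suc s) (λ u → + εTerm q E (d ∸ r) (s ∸ u) *ℤ altTerm q r u))
      ≡⟨ ∑-convolution (λ j → + εTerm q E (d ∸ r) j) (altTerm q r) a ⟩
    ∑ (suc a) (λ j → + εTerm q E (d ∸ r) j *ℤ ∑ (suc (a ∸ j)) (altTerm q r)) ∎

  lam′-rank0 : ∀ {d a} → a ≤ d →
    lam′ q E d 0 a ≡ sumRange 0 a (λ s → + (gauss q d s * q ^ choose2 (d ∸ s) * E (d ∸ s)))
  lam′-rank0 {d} {a} a≤d = begin
    lam′ q E d 0 a
      ≡⟨ lam′-convolution z≤n a≤d ⟩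
    ∑ (suc a) (λ j → + εTerm q E d j *ℤ ∑ (suc (a ∸ j)) (altTerm q 0))
      ≡⟨ ∑-cong (suc a) (λ j _ → trans (cong (+ εTerm q E d j *ℤ_) (∑-altTerm₀ q (a ∸ j))) (ℤₚ.*-identityʳ (+ εTerm q E d j))) ⟩
    ∑ (suc a) (λ j → + εTerm q E d j)
      ≡⟨ ∑-cong (suc a) (λ j _ → cong (λ g → + (g * q ^ choose2 (d ∸ j) * E (d ∸ j))) (sym (gauss≡qbinom q≥2 d j))) ⟩
    ∑ (suc a) (λ j → + (gauss q d j * q ^ choose2 (d ∸ j) * E (d ∸ j)))
      ≡⟨ sym (sumRange≡∑ 0 a (λ s → + (gauss q d s * q ^ choose2 (d ∸ s) * E (d ∸ s)))) ⟩
    sumRange 0 a (λ s → + (gauss q d s * q ^ choose2 (d ∸ s) * E (d ∸ s))) ∎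

  εTerm*altPrefix≡ : ∀ {d r a j} → j ≤ a →
    + εTerm q E (d ∸ suc r) j *ℤ altPrefix q r (a ∸ j) ≡ sgn (suc r + a) *ℤ (sgn j *ℤ + Aterm′ q E d (suc r) j a)
  εTerm*altPrefix≡ {d} {r} {a} {j} j≤a
    rewrite gauss≡qbinom q≥2 (d ∸ suc r) j | gauss≡qbinom q≥2 (suc r ∸ 1) (a ∸ j) with a ∸ j ≤? r
  ... | yes a∸j≤r
    rewrite m+n∸o≡m∸[o∸n] (suc r) j≤a | sgn[m∸[n∸k]] {suc r} j≤a (ℕₚ.m≤n⇒m≤1+n a∸j≤r) =
    regroup (sgn (suc r + a)) (sgn j) (εTerm q E (d ∸ suc r) j) (qbinom q r (a ∸ j)) (q ^ choose2 (suc r ∸ (a ∸ j)))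
    where
    regroup : ∀ s₁ s₂ b g c → + b *ℤ ((s₁ *ℤ s₂) *ℤ + (g * c)) ≡ s₁ *ℤ (s₂ *ℤ + (b * g * c))
    regroup s₁ s₂ b g c = begin
      + b *ℤ ((s₁ *ℤ s₂) *ℤ + (g * c))        ≡⟨ cong (λ x → + b *ℤ ((s₁ *ℤ s₂) *ℤ x)) (ℤₚ.pos-* g c) ⟩
      + b *ℤ ((s₁ *ℤ s₂) *ℤ (+ g *ℤ + c))     ≡⟨ reassociate s₁ s₂ (+ b) (+ g) (+ c) ⟩
      s₁ *ℤ (s₂ *ℤ (+ b *ℤ + g *ℤ + c))       ≡⟨ cong (λ x → s₁ *ℤ (s₂ *ℤ (x *ℤ + c))) (sym (ℤₚ.pos-* b g)) ⟩
      s₁ *ℤ (s₂ *ℤ (+ (b * g) *ℤ + c))        ≡⟨ cong (λ x → s₁ *ℤ (s₂ *ℤ x)) (sym (ℤₚ.pos-* (b * g) c)) ⟩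
      s₁ *ℤ (s₂ *ℤ + (b * g * c))             ∎
      where
      reassociate : ∀ s₁ s₂ b g c → b *ℤ ((s₁ *ℤ s₂) *ℤ (g *ℤ c)) ≡ s₁ *ℤ (s₂ *ℤ (b *ℤ g *ℤ c))
      reassociate = ℤ-Solver.solve-∀
  ... | no a∸j≰r rewrite k>n⇒qbinom≡0 q (ℕₚ.≰⇒> a∸j≰r) = begin
    + b *ℤ (sgn (suc r ∸ (a ∸ j)) *ℤ + 0)    ≡⟨ cong (+ b *ℤ_) (ℤₚ.*-zeroʳ (sgn (suc r ∸ (a ∸ j)))) ⟩
    + b *ℤ + 0                              ≡⟨ ℤₚ.*-zeroʳ (+ b) ⟩
    + 0                                     ≡⟨ sym (ℤₚ.*-zeroʳ (sgn (suc r + a))) ⟩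
    sgn (suc r + a) *ℤ + 0                  ≡⟨ cong (sgn (suc r + a) *ℤ_) (sym (ℤₚ.*-zeroʳ (sgn j))) ⟩
    sgn (suc r + a) *ℤ (sgn j *ℤ + 0)       ≡⟨ cong (λ n → sgn (suc r + a) *ℤ (sgn j *ℤ + (n * c))) (sym (ℕₚ.*-zeroʳ b)) ⟩
    sgn (suc r + a) *ℤ (sgn j *ℤ + (b * 0 * c)) ∎
    where
    b = εTerm q E (d ∸ suc r) j
    c = q ^ choose2 (suc r + j ∸ a)

  lam′-positive : ∀ {d r a} → suc r ≤ d → a ≤ d →
    lam′ q E d (suc r) a
      ≡ sgn (suc r + a) *ℤ sumRange (suc a ∸ suc r) (a ⊓ (d ∸ suc r)) (λ j → sgn j *ℤ + Aterm′ q E d (suc r) j a)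
  lam′-positive {d} {r} {a} r<d a≤d = begin
    lam′ q E d (suc r) a
      ≡⟨ lam′-convolution r<d a≤d ⟩
    ∑ (suc a) (λ j → + εTerm q E n j *ℤ ∑ (suc (a ∸ j)) (altTerm q (suc r)))
      ≡⟨ ∑-cong (suc a) (λ j _ → cong (+ εTerm q E n j *ℤ_) (∑-altTerm r (a ∸ j))) ⟩
    ∑ (suc a) (λ j → + εTerm q E n j *ℤ altPrefix q r (a ∸ j))
      ≡⟨ ∑-cong (suc a) (λ j j≤a → εTerm*altPrefix≡ {d} {r} (ℕₚ.≤-pred j≤a)) ⟩
    ∑ (suc a) (λ j → sgn (suc r + a) *ℤ A j)
      ≡⟨ sym (∑-distribˡ (suc a) (sgn (suc r + a)) A) ⟩
    sgn (suc r + a) *ℤ ∑ (suc a) A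
      ≡⟨ cong (sgn (suc r + a) *ℤ_) (sym (sumRange-support (a ∸ r) (a ⊓ n) a A (ℕₚ.m⊓n≤m a n) below above)) ⟩
    sgn (suc r + a) *ℤ sumRange (suc a ∸ suc r) (a ⊓ n) A ∎
    where
    n = d ∸ suc r
    A : ℕ → ℤ
    A j = sgn j *ℤ + Aterm′ q E d (suc r) j a
    below : ∀ j → j < a ∸ r → j ≤ a → A j ≡ + 0
    below j j<a∸r _ = trans (cong (λ x → sgn j *ℤ + x) (Aterm′-below q E {d} j<a∸r)) (ℤₚ.*-zeroʳ (sgn j))
    above : ∀ j → a ⊓ n < j → j ≤ a → A j ≡ + 0
    above j hi<j j≤a = trans (cong (λ x → sgn j *ℤ + x) (Aterm′-above q E {d} {suc r} {a} n<j)) (ℤₚ.*-zeroʳ (sgn j))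
      where n<j = ℕₚ.≰⇒> (λ j≤n → ℕₚ.<⇒≱ hi<j (ℕₚ.⊓-glb j≤a j≤n))

order≥2 : ∀ t {ρ} → IsPrimePower ρ → 2 ≤ order t ρ
order≥2 t (p , k , p-prime , refl) = by-type t
  where
  ρ≥2 : 2 ≤ p ^ suc k
  ρ≥2 = 2≤m^[1+n] k (ℕ.nonTrivial⇒n>1 p {{prime⇒nonTrivial p-prime}})
  ρ²≥2 : 2 ≤ p ^ suc k * p ^ suc k
  ρ²≥2 = ℕₚ.≤-trans ρ≥2 (ℕₚ.m≤m*n (p ^ suc k) (p ^ suc k) {{ℕ.>-nonZero (ℕₚ.≤-trans (s≤s z≤n) ρ≥2)}})
  by-type : ∀ t → 2 ≤ order t (p ^ suc k)
  by-type Qplus  = ρ≥2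
  by-type Hodd   = ρ²≥2
  by-type Qpar   = ρ≥2
  by-type W      = ρ≥2
  by-type Heven  = ρ²≥2
  by-type Qminus = ρ≥2

theorem7p4 : (t : PolarType) (ρ : ℕ) → IsPrimePower ρ → (d : ℕ) → 1 ≤ d → (a : ℕ) → a < d →
    (lam t ρ d 0 a ≡ sumRange 0 a (λ s → + (gauss (order t ρ) d s * order t ρ ^ choose2 (d ∸ s) * qε t ρ (d ∸ s))))
    × ((r : ℕ) → 0 < r → r ≤ d →
        lam t ρ d r a ≡ sgn (r + a) ℤ.* sumRange (suc a ∸ r) (a ⊓ (d ∸ r)) (λ s → sgn s ℤ.* + Aterm t ρ d r s a))
theorem7p4 t ρ ρ-prime-power d _ a a<d = lam′-rank0 q≥2 E a≤d , λ where
    (suc r) _ r<d → lam′-positive q≥2 E r<d a≤d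
  where
  q≥2 = order≥2 t ρ-prime-power
  E = qε t ρ
  a≤d = ℕₚ.<⇒≤ a<d
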